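{- Let $n\ge 3$ be an integer. Let $A'\subset\mathbb N$ be a $B_3$ set (in $\mathbb Z$) of cardinality $n-1$ with $0\in A'$, and let $r=\max A'$. Let $k,m$ be positive integers with $k\ge r+1$, $m\ge 3k+6r+2$ and $m\equiv k\pmod 2$. Let $a=(3m+k)/2$, $A=a+A'=\{a+x\mid x\in A'\}$, and $S=\langle\{m\}\cup A\rangle_{4m}$. Then $W_0(S)=-\binom{n}{3}$.
   Context: $\mathbb N=\{0,1,2,\dots\}$. A numerical semigroup is a submonoid $S\subseteq\mathbb N$ (containing $0$ and closed under addition) with finite complement in $\mathbb N$. Let $S^*=S\setminus\{0\}$. The multiplicity is $m=\min S^*$; the conductor $c$ is the least integer with $c+\mathbb N\subseteq S$. Set $q=\lceil c/m\rceil$ and $\rho=qm-c$. Let $P$ be the set of primitive elements of $S$ (elements of $S^*$ not expressible as $a_1+a_2$ with $a_1,a_2\in S^*$), $D=S^*+S^*$, $L=S\cap\{0,1,\dots,c-1\}$, $D_q=D\cap\{c,\dots,c+m-1\}$, and $W_0(S)=|P\cap L||L|-q|D_q|+\rho$. For a finite set $B$ of positive integers and a positive integer $t$, $\langle B\rangle_t$ denotes the set of all finite $\mathbb N$-linear combinations of elements of $B$, together with all integers $\ge t$; it is a numerical semigroup. A finite subset $A'\subset\mathbb Z$ is a $B_3$ set if for all $a_1,a_2,a_3,b_1,b_2,b_3\in A'$, $a_1+a_2+a_3=b_1+b_2+b_3$ holds only if $(a_1,a_2,a_3)$ is a permutation of $(b_1,b_2,b_3)$. -}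

module Defs where

open import Data.Bool using (Bool; true; false; _∧_; _∨_; not; if_then_else_)
open import Data.Nat using (ℕ; zero; suc; _+_; _*_; _∸_; _≤ᵇ_; _<ᵇ_; _≡ᵇ_)
open import Data.List using (List; []; _∷_; map; filter; length; upTo)
open import Data.Bool.ListAction using (any; all)
open import Data.Integer as ℤ using (ℤ; +_)
open import Data.List.Membership.Propositional using (_∈_)
open import Data.List.Relation.Binary.Permutation.Propositional using (_↭_)
open import Relation.Binary.PropositionalEquality using (_≡_)

range : ℕ → ℕ → List ℕ
range lo hi = map (λ i → lo + i) (upTo (hi ∸ lo))

count : (ℕ → Bool) → List ℕ → ℕ
count p xs = length (filter (λ x → Data.Bool._≟_ (p x) true) xs)
  where import Data.Bool

-- A (decidable) subset S of ℕ together with a number `bound` such that every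
-- integer ≥ bound lies in S (so the complement is finite).
record NSData : Set where
  field
    mem   : ℕ → Bool
    bound : ℕ
open NSData public

firstWith : (ℕ → Bool) → List ℕ → ℕ → ℕ
firstWith p []       d = d
firstWith p (x ∷ xs) d = if p x then x else firstWith p xs d

module _ (S : NSData) where
  memStar : ℕ → Bool
  memStar x = (1 ≤ᵇ x) ∧ mem S x

  -- multiplicity m = min S*  (bound + 1 ∈ S* always)
  multiplicity : ℕ
  multiplicity = firstWith memStar (range 1 (suc (bound S))) (suc (bound S))

  conductor : ℕ
  conductor = firstWith (λ c → all (mem S) (range c (bound S))) (range 0 (bound S)) (bound S)

  -- q = ⌈ c / m ⌉ = least q with c ≤ q m
  qOf : ℕ
  qOf = firstWith (λ q → conductor ≤ᵇ q * multiplicity) (range 0 (suc conductor)) conductor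

  ρOf : ℕ
  ρOf = qOf * multiplicity ∸ conductor

  inD : ℕ → Bool
  inD x = any (λ a → memStar a ∧ memStar (x ∸ a)) (range 1 x)

  isPrimitive : ℕ → Bool
  isPrimitive x = memStar x ∧ not (inD x)

  cardL : ℕ
  cardL = count (mem S) (range 0 conductor)

  cardPL : ℕ
  cardPL = count isPrimitive (range 0 conductor)

  cardDq : ℕ
  cardDq = count inD (range conductor (conductor + multiplicity))

  W₀ : ℤ
  W₀ = (+ (cardPL * cardL) ℤ.- + (qOf * cardDq)) ℤ.+ + ρOf

-- x is an ℕ-linear combination of the elements of B
-- (for b ≥ 1 a coefficient j of b satisfies j ≤ x; for b = 0 only j = 0 matters)
isComb : List ℕ → ℕ → Bool
isComb []       x = x ≡ᵇ 0
isComb (b ∷ bs) x = any (λ j → (j * b ≤ᵇ x) ∧ isComb bs (x ∸ j * b)) (range 0 (suc x))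

⟨_⟩_ : List ℕ → ℕ → NSData
⟨ B ⟩ t = record { mem = λ x → isComb B x ∨ (t ≤ᵇ x) ; bound = t }

IsB₃ : List ℕ → Set
IsB₃ A = ∀ {a₁ a₂ a₃ b₁ b₂ b₃} → a₁ ∈ A → a₂ ∈ A → a₃ ∈ A → b₁ ∈ A → b₂ ∈ A → b₃ ∈ A →
  a₁ + a₂ + a₃ ≡ b₁ + b₂ + b₃ → (a₁ ∷ a₂ ∷ a₃ ∷ []) ↭ (b₁ ∷ b₂ ∷ b₃ ∷ [])

module Submission where

-- Below 5m every element of S has the form  value (j , t) s = j m + t a + s  with s
-- the sum of a t-element multiset from A′.  Since 2a = 3m + k,
--     2 · value (j , t) s = (2j + 3t) m + (t k + 2s),
-- and the bound on m keeps the excess t k + 2s below m for t ≤ 3: the position of an element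
-- determines its weight 2j + 3t, and within one weight r < k separates t from t + 2.  So
--   * L = S ∩ [0, 4m) is the disjoint union of the blocks of weight < 8,
--   * its primitive elements are the blocks with j + t = 1, i.e. m and a + A′,
--   * D ∩ [4m, 5m) is the disjoint union of the blocks of weight 8 and 9,
-- and by the B₃ property distinct multisets of size ≤ 3 have distinct sums, so a block has one
-- element per multiset.  Moreover 4m − 1 ∉ S, whence c = 4m, the multiplicity is m, q = 4 and
-- ρ = 0; counting multisets (n − 1, C(n, 2), C(n + 1, 3) of sizes 1, 2, 3) gives −C(n, 3).

open import Defs
open import Data.Nat using (ℕ; _+_; _*_; _∸_; _≤_; _%_)
open import Data.Nat.Combinatorics using (_C_)
open import Data.Integer using (-_; +_)
open import Data.List using (List; map; length; _∷_)
open import Data.List.Membership.Propositional using (_∈_)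
open import Data.List.Relation.Unary.All using (All)
open import Data.List.Relation.Unary.Unique.Propositional using (Unique)
open import Relation.Binary.PropositionalEquality using (_≡_)

open import Data.Bool as Bool using (Bool; true; false; T; _∧_; _∨_; not)
open import Data.Bool.ListAction using (all)
open import Data.Bool.Properties using (T-≡; T-∧; T-∨; T-not-≡)
open import Data.Empty using (⊥; ⊥-elim)
open import Data.Integer as ℤ using (_⊖_)
import Data.Integer.Properties as ℤₚ
open import Data.List using ([]; filter; upTo; applyUpTo; _++_; cartesianProduct; replicate)
open import Data.List.Properties using (map-applyUpTo; length-++; length-map; length-replicate)
open import Data.List.Membership.Propositional using (find; lose)
open import Data.List.Membership.Propositional.Properties
  using (∈-map⁺; ∈-map⁻; ∈-upTo⁺; ∈-upTo⁻; ∈-filter⁺; ∈-filter⁻; ∈-++⁺ˡ; ∈-++⁺ʳ; ∈-++⁻;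
         ∈-cartesianProduct⁺; ∈-cartesianProduct⁻)
open import Data.List.Membership.Propositional.Properties.WithK using (unique∧set⇒bag)
open import Data.List.Relation.Binary.BagAndSetEquality using (∼bag⇒↭)
open import Data.List.Relation.Binary.Permutation.Propositional using (_↭_)
open import Data.List.Relation.Binary.Permutation.Propositional.Properties
  using (↭-length; drop-∷; ∈-resp-↭)
open import Data.List.Relation.Unary.All as All using ([]; _∷_)
import Data.List.Relation.Unary.All.Properties as Allₚ
import Data.List.Relation.Unary.AllPairs as AllPairs
open import Data.List.Relation.Unary.Any using (here; there)
open import Data.List.Relation.Unary.Any.Properties using (any⁺; any⁻)
import Data.List.Relation.Unary.Unique.Propositional.Properties as Uniqueₚ
open import Data.Nat
open import Data.Nat.Combinatorics using (nC1≡n; nCk+nC[k+1]≡[n+1]C[k+1]; k>n⇒nCk≡0)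
open import Data.Nat.ListAction using (sum)
open import Data.Nat.ListAction.Properties using (sum-++)
open import Data.Nat.Properties
open import Data.Nat.Tactic.RingSolver using (solve-∀)
open import Data.Product using (∃; _×_; _,_; proj₁; proj₂)
open import Data.Sum using (_⊎_; inj₁; inj₂)
open import Data.Unit using (⊤; tt)
open import Function using (_∘_; mk⇔; Equivalence)
open import Relation.Binary.PropositionalEquality
open import Relation.Nullary using (¬_; Dec; yes; no)

¬T⇒≡false : ∀ {b} → ¬ T b → b ≡ false
¬T⇒≡false {false} _  = refl
¬T⇒≡false {true}  ¬t = ⊥-elim (¬t _)

∈-range⁻ : ∀ {lo hi x} → x ∈ range lo hi → lo ≤ x × x < hi
∈-range⁻ {lo} {hi} x∈ with ∈-map⁻ (_+_ lo) x∈
... | i , i∈ , refl = m≤m+n lo i , subst (lo + i <_) (m+[n∸m]≡n lo≤hi) (+-monoʳ-< lo i<)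
  where
  i< : i < hi ∸ lo
  i< = ∈-upTo⁻ i∈
  lo≤hi : lo ≤ hi
  lo≤hi = <⇒≤ (m∸n≢0⇒n<m (λ hi∸lo≡0 → n≮0 (subst (i <_) hi∸lo≡0 i<)))

∈-range⁺ : ∀ {lo hi x} → lo ≤ x → x < hi → x ∈ range lo hi
∈-range⁺ {lo} {hi} lo≤x x<hi =
  subst (_∈ range lo hi) (m+[n∸m]≡n lo≤x) (∈-map⁺ (_+_ lo) (∈-upTo⁺ (∸-monoˡ-< x<hi lo≤x)))

range-unique : ∀ lo hi → Unique (range lo hi)
range-unique lo hi = Uniqueₚ.map⁺ (+-cancelˡ-≡ lo _ _) (Uniqueₚ.upTo⁺ (hi ∸ lo))

applyUpTo-cong : ∀ {f g : ℕ → ℕ} → (∀ i → f i ≡ g i) → ∀ n → applyUpTo f n ≡ applyUpTo g n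
applyUpTo-cong f≗g zero    = refl
applyUpTo-cong f≗g (suc n) = cong₂ _∷_ (f≗g 0) (applyUpTo-cong (f≗g ∘ suc) n)

range-cons : ∀ {lo hi} → lo < hi → range lo hi ≡ lo ∷ range (suc lo) hi
range-cons {lo} {hi} lo<hi with hi ∸ lo in hi∸lo≡
... | zero  = ⊥-elim (m>n⇒m∸n≢0 lo<hi hi∸lo≡)
... | suc d = begin
  map (_+_ lo) (upTo (suc d))              ≡⟨ map-applyUpTo (λ i → i) (_+_ lo) (suc d) ⟩
  lo + 0 ∷ applyUpTo (λ i → lo + suc i) d  ≡⟨ cong₂ _∷_ (+-identityʳ lo) (applyUpTo-cong (+-suc lo) d) ⟩
  lo ∷ applyUpTo (_+_ (suc lo)) d          ≡⟨ cong (lo ∷_) (map-applyUpTo (λ i → i) (_+_ (suc lo)) d) ⟨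
  lo ∷ map (_+_ (suc lo)) (upTo d)         ≡⟨ cong (λ n → lo ∷ map (_+_ (suc lo)) (upTo n)) d≡ ⟨
  lo ∷ range (suc lo) hi                   ∎
  where
  open ≡-Reasoning
  d≡ : hi ∸ suc lo ≡ d
  d≡ = trans (sym (pred[m∸n]≡m∸[1+n] hi lo)) (cong pred hi∸lo≡)

count-enumeration : ∀ (p : ℕ → Bool) {xs ys} → Unique xs → Unique ys →
  (∀ {y} → y ∈ ys → y ∈ xs × T (p y)) → (∀ {x} → x ∈ xs → T (p x) → x ∈ ys) →
  count p xs ≡ length ys
count-enumeration p {xs} {ys} uxs uys ys⊆ ⊆ys =
  ↭-length (∼bag⇒↭ (unique∧set⇒bag (Uniqueₚ.filter⁺ P? uxs) uys (mk⇔ to from)))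
  where
  P? : (x : ℕ) → Dec (p x ≡ true)
  P? x = p x Bool.≟ true
  to : ∀ {x} → x ∈ filter P? xs → x ∈ ys
  to x∈ with ∈-filter⁻ P? x∈
  ... | x∈xs , px = ⊆ys x∈xs (Equivalence.from T-≡ px)
  from : ∀ {y} → y ∈ ys → y ∈ filter P? xs
  from y∈ with ys⊆ y∈
  ... | y∈xs , py = ∈-filter⁺ P? y∈xs (Equivalence.to T-≡ py)

firstWith-none : ∀ p xs d → (∀ {x} → x ∈ xs → ¬ T (p x)) → firstWith p xs d ≡ d
firstWith-none p []       d none = refl
firstWith-none p (x ∷ xs) d none rewrite ¬T⇒≡false (none (here refl)) =
  firstWith-none p xs d (none ∘ there)

firstWith-least : ∀ p {lo hi v} d → lo ≤ v → v < hi → T (p v) →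
  (∀ {x} → lo ≤ x → x < v → ¬ T (p x)) → firstWith p (range lo hi) d ≡ v
firstWith-least p {lo} {hi} {v} d lo≤v v<hi pv below =
  go (v ∸ lo) lo (m∸n+n≡m lo≤v) lo≤v below
  where
  go : ∀ n lo → n + lo ≡ v → lo ≤ v → (∀ {x} → lo ≤ x → x < v → ¬ T (p x)) →
       firstWith p (range lo hi) d ≡ v
  go zero    lo refl _    _     rewrite range-cons v<hi | Equivalence.to T-≡ pv = refl
  go (suc n) lo n+lo≡v lo≤v below = step (subst (lo <_) n+lo≡v (m<n+m lo z<s))
    where
    step : lo < v → firstWith p (range lo hi) d ≡ v
    step lo<v rewrite range-cons (<-trans lo<v v<hi) | ¬T⇒≡false (below ≤-refl lo<v) =
      go n (suc lo) (trans (+-suc n lo) n+lo≡v) lo<v (λ lo<x → below (<⇒≤ lo<x))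

data Combination : List ℕ → ℕ → Set where
  []  : Combination [] 0
  _∷_ : ∀ {b bs z} j → Combination bs z → Combination (b ∷ bs) (j * b + z)

isComb⇒Combination : ∀ B x → T (isComb B x) → Combination B x
isComb⇒Combination []       x ok rewrite ≡ᵇ⇒≡ x 0 ok = []
isComb⇒Combination (b ∷ bs) x ok with find (any⁻ _ (range 0 (suc x)) ok)
... | j , _ , jb-ok with Equivalence.to T-∧ jb-ok
...   | jb≤x , rest = subst (Combination (b ∷ bs)) (m+[n∸m]≡n (≤ᵇ⇒≤ (j * b) x jb≤x))
                        (j ∷ isComb⇒Combination bs (x ∸ j * b) rest)

Combination⇒isComb : ∀ {B x} → All (1 ≤_) B → Combination B x → T (isComb B x)
Combination⇒isComb []             []                  = _
Combination⇒isComb (1≤b ∷ 1≤bs) (_∷_ {b} {bs} {z} j c) =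
  any⁺ _ (lose (∈-range⁺ z≤n (s≤s j≤x))
    (Equivalence.from T-∧ (≤⇒≤ᵇ (m≤m+n (j * b) z) ,
      subst (T ∘ isComb bs) (sym (m+n∸m≡n (j * b) z)) (Combination⇒isComb 1≤bs c))))
  where
  j≤x : j ≤ j * b + z
  j≤x = ≤-trans (m≤m*n j b {{>-nonZero 1≤b}}) (m≤m+n (j * b) z)

combination-zero : ∀ B → Combination B 0
combination-zero []       = []
combination-zero (b ∷ bs) = 0 ∷ combination-zero bs

combination-+ : ∀ {B x y} → Combination B x → Combination B y → Combination B (x + y)
combination-+ []        []          = []
combination-+ (_∷_ {b} {z = z} i c) (_∷_ {z = z′} j c′) =
  subst (Combination _) (regroup i j b z z′) ((i + j) ∷ combination-+ c c′)
  where
  regroup : ∀ i j b z z′ → (i + j) * b + (z + z′) ≡ (i * b + z) + (j * b + z′)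
  regroup = solve-∀

combination-generator : ∀ {B x} → x ∈ B → Combination B x
combination-generator {b ∷ bs} (here refl) =
  subst (Combination _) (trans (+-identityʳ (1 * b)) (*-identityˡ b)) (1 ∷ combination-zero bs)
combination-generator {b ∷ bs} (there x∈) = 0 ∷ combination-generator x∈

-- `sums t L`: the sums of the t-element multisets drawn from L, one entry per multiset
-- (multisets containing the head x of L, and multisets avoiding it).
sums : ℕ → List ℕ → List ℕ
sums zero    L        = 0 ∷ []
sums (suc t) []       = []
sums (suc t) (x ∷ xs) = map (_+_ x) (sums t (x ∷ xs)) ++ sums (suc t) xs

sums-∷⁻ : ∀ t x xs {s} → s ∈ sums (suc t) (x ∷ xs) →
  (∃ λ s′ → s′ ∈ sums t (x ∷ xs) × s ≡ x + s′) ⊎ s ∈ sums (suc t) xs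
sums-∷⁻ t x xs s∈ with ∈-++⁻ (map (_+_ x) (sums t (x ∷ xs))) s∈
... | inj₁ s∈₁ = inj₁ (∈-map⁻ (_+_ x) s∈₁)
... | inj₂ s∈₂ = inj₂ s∈₂

sums-weaken : ∀ t x xs {s} → s ∈ sums t xs → s ∈ sums t (x ∷ xs)
sums-weaken zero    x xs s∈ = s∈
sums-weaken (suc t) x xs s∈ = ∈-++⁺ʳ (map (_+_ x) (sums t (x ∷ xs))) s∈

sums-copies : ∀ j t x xs {s} → s ∈ sums t xs → j * x + s ∈ sums (j + t) (x ∷ xs)
sums-copies zero    t x xs s∈ = sums-weaken t x xs s∈
sums-copies (suc j) t x xs {s} s∈ =
  subst (_∈ sums (suc j + t) (x ∷ xs)) (sym (+-assoc x (j * x) s))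
    (∈-++⁺ˡ (∈-map⁺ (_+_ x) (sums-copies j t x xs s∈)))

sums-split : ∀ t L {s} → s ∈ sums (suc t) L →
  ∃ λ z → ∃ λ s′ → z ∈ L × s′ ∈ sums t L × s ≡ z + s′
sums-split t (x ∷ xs) s∈ with sums-∷⁻ t x xs s∈
... | inj₁ (s′ , s′∈ , refl) = x , s′ , here refl , s′∈ , refl
... | inj₂ s∈′ with sums-split t xs s∈′
...   | z , s′ , z∈ , s′∈ , refl = z , s′ , there z∈ , sums-weaken t x xs s′∈ , refl

sums-bound : ∀ {r} t L {s} → All (_≤ r) L → s ∈ sums t L → s ≤ t * r
sums-bound zero    L _ (here refl) = z≤n
sums-bound {r} (suc t) L = along L
  where
  along : ∀ L {s} → All (_≤ r) L → s ∈ sums (suc t) L → s ≤ suc t * r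
  along (x ∷ xs) (x≤r ∷ xs≤r) s∈ with sums-∷⁻ t x xs s∈
  ... | inj₁ (s′ , s′∈ , refl) = +-mono-≤ x≤r (sums-bound t (x ∷ xs) (x≤r ∷ xs≤r) s′∈)
  ... | inj₂ s∈′               = along xs xs≤r s∈′

MultisetSum : ℕ → List ℕ → ℕ → Set
MultisetSum t L s = ∃ λ M → length M ≡ t × All (_∈ L) M × sum M ≡ s

sums-multiset : ∀ t L {s} → s ∈ sums t L → MultisetSum t L s
sums-multiset zero    L (here refl) = [] , refl , [] , refl
sums-multiset (suc t) L = along L
  where
  along : ∀ L {s} → s ∈ sums (suc t) L → MultisetSum (suc t) L s
  along (x ∷ xs) s∈ with sums-∷⁻ t x xs s∈
  ... | inj₁ (s′ , s′∈ , refl) with sums-multiset t (x ∷ xs) s′∈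
  ...   | M , |M| , M⊆ , ΣM = x ∷ M , cong suc |M| , here refl ∷ M⊆ , cong (_+_ x) ΣM
  along (x ∷ xs) s∈ | inj₂ s∈′ with along xs s∈′
  ...   | M , |M| , M⊆ , ΣM = M , |M| , All.map there M⊆ , ΣM

shifted-combination⁻ : ∀ a L {y} → Combination (map (_+_ a) L) y →
  ∃ λ t → ∃ λ s → s ∈ sums t L × y ≡ t * a + s
shifted-combination⁻ a []       []      = 0 , 0 , here refl , refl
shifted-combination⁻ a (x ∷ xs) (j ∷ c) with shifted-combination⁻ a xs c
... | t , s , s∈ , refl = j + t , j * x + s , sums-copies j t x xs s∈ , regroup j a x t s
  where
  regroup : ∀ j a x t s → j * (a + x) + (t * a + s) ≡ (j + t) * a + (j * x + s)
  regroup = solve-∀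

shifted-combination⁺ : ∀ a t L {s} → s ∈ sums t L → Combination (map (_+_ a) L) (t * a + s)
shifted-combination⁺ a zero    L (here refl) = combination-zero _
shifted-combination⁺ a (suc t) L = along L
  where
  along : ∀ L {s} → s ∈ sums (suc t) L → Combination (map (_+_ a) L) (suc t * a + s)
  along (x ∷ xs) s∈ with sums-∷⁻ t x xs s∈
  ... | inj₁ (s′ , s′∈ , refl) =
    subst (Combination _) (regroup a x t s′)
      (combination-+ (combination-generator (here refl)) (shifted-combination⁺ a t (x ∷ xs) s′∈))
    where
    regroup : ∀ a x t s′ → a + x + (t * a + s′) ≡ suc t * a + (x + s′)
    regroup = solve-∀
  ... | inj₂ s∈′ = 0 ∷ along xs s∈′

length-sums-∷ : ∀ t x xs →
  length (sums (suc t) (x ∷ xs)) ≡ length (sums t (x ∷ xs)) + length (sums (suc t) xs)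
length-sums-∷ t x xs = begin
  length (map (_+_ x) (sums t (x ∷ xs)) ++ sums (suc t) xs)
    ≡⟨ length-++ (map (_+_ x) (sums t (x ∷ xs))) ⟩
  length (map (_+_ x) (sums t (x ∷ xs))) + length (sums (suc t) xs)
    ≡⟨ cong (_+ length (sums (suc t) xs)) (length-map (_+_ x) (sums t (x ∷ xs))) ⟩
  length (sums t (x ∷ xs)) + length (sums (suc t) xs) ∎
  where open ≡-Reasoning

length-sums₁ : ∀ L → length (sums 1 L) ≡ length L
length-sums₁ []       = refl
length-sums₁ (x ∷ xs) = trans (length-sums-∷ 0 x xs) (cong suc (length-sums₁ xs))

length-sums₂ : ∀ L → 2 * length (sums 2 L) ≡ length L * suc (length L)
length-sums₂ []       = refl
length-sums₂ (x ∷ xs) = begin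
  2 * length (sums 2 (x ∷ xs))                    ≡⟨ cong (2 *_) (length-sums-∷ 1 x xs) ⟩
  2 * (length (sums 1 (x ∷ xs)) + length (sums 2 xs))
    ≡⟨ *-distribˡ-+ 2 (length (sums 1 (x ∷ xs))) (length (sums 2 xs)) ⟩
  2 * length (sums 1 (x ∷ xs)) + 2 * length (sums 2 xs)
    ≡⟨ cong₂ (λ u v → 2 * u + v) (length-sums₁ (x ∷ xs)) (length-sums₂ xs) ⟩
  2 * suc ℓ + ℓ * suc ℓ                           ≡⟨ pascal ℓ ⟩
  suc ℓ * suc (suc ℓ)                             ∎
  where
  open ≡-Reasoning
  ℓ = length xs
  pascal : ∀ ℓ → 2 * suc ℓ + ℓ * suc ℓ ≡ suc ℓ * suc (suc ℓ)
  pascal = solve-∀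

length-sums₃ : ∀ L → 6 * length (sums 3 L) ≡ length L * suc (length L) * suc (suc (length L))
length-sums₃ []       = refl
length-sums₃ (x ∷ xs) = begin
  6 * length (sums 3 (x ∷ xs))                    ≡⟨ cong (6 *_) (length-sums-∷ 2 x xs) ⟩
  6 * (length (sums 2 (x ∷ xs)) + length (sums 3 xs))
    ≡⟨ split (length (sums 2 (x ∷ xs))) (length (sums 3 xs)) ⟩
  3 * (2 * length (sums 2 (x ∷ xs))) + 6 * length (sums 3 xs)
    ≡⟨ cong₂ (λ u v → 3 * u + v) (length-sums₂ (x ∷ xs)) (length-sums₃ xs) ⟩
  3 * (suc ℓ * suc (suc ℓ)) + ℓ * suc ℓ * suc (suc ℓ) ≡⟨ pascal ℓ ⟩
  suc ℓ * suc (suc ℓ) * suc (suc (suc ℓ))         ∎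
  where
  open ≡-Reasoning
  ℓ = length xs
  split : ∀ u v → 6 * (u + v) ≡ 3 * (2 * u) + 6 * v
  split = solve-∀
  pascal : ∀ ℓ → 3 * (suc ℓ * suc (suc ℓ)) + ℓ * suc ℓ * suc (suc ℓ) ≡ suc ℓ * suc (suc ℓ) * suc (suc (suc ℓ))
  pascal = solve-∀

↭-cancel-prefix : ∀ (ws : List ℕ) {xs ys} → ws ++ xs ↭ ws ++ ys → xs ↭ ys
↭-cancel-prefix []       p = p
↭-cancel-prefix (w ∷ ws) p = ↭-cancel-prefix ws (drop-∷ p)

module B₃Sums {A′ : List ℕ} (isB₃ : IsB₃ A′) where

  b₃-multisets : ∀ {M N} → length M ≡ 3 → length N ≡ 3 → All (_∈ A′) M → All (_∈ A′) N →
    sum M ≡ sum N → M ↭ N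
  b₃-multisets {a₁ ∷ a₂ ∷ a₃ ∷ []} {b₁ ∷ b₂ ∷ b₃ ∷ []} _ _
               (a₁∈ ∷ a₂∈ ∷ a₃∈ ∷ []) (b₁∈ ∷ b₂∈ ∷ b₃∈ ∷ []) ΣM≡ΣN =
    isB₃ a₁∈ a₂∈ a₃∈ b₁∈ b₂∈ b₃∈ (trans (sym (assoc a₁ a₂ a₃)) (trans ΣM≡ΣN (assoc b₁ b₂ b₃)))
    where
    assoc : ∀ x y z → x + (y + (z + 0)) ≡ x + y + z
    assoc = solve-∀

  -- The induction pads both multisets with a common
  -- multiset `pad` of size 3 − t; a coincidence between a multiset containing the head x
  -- and one avoiding it would, by B₃, put x into the tail.
  sums-unique : ∀ t L pad → t + length pad ≡ 3 → All (_∈ A′) pad → All (_∈ A′) L → Unique L →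
    Unique (sums t L)
  sums-unique zero    L        pad _ _ _ _ = [] AllPairs.∷ AllPairs.[]
  sums-unique (suc t) []       pad _ _ _ _ = AllPairs.[]
  sums-unique (suc t) (x ∷ xs) pad size pad⊆ (x∈ ∷ xs⊆) (x∉xs AllPairs.∷ uxs) =
    Uniqueₚ.++⁺ (Uniqueₚ.map⁺ (+-cancelˡ-≡ x _ _)
                  (sums-unique t (x ∷ xs) (x ∷ pad) (trans (+-suc t (length pad)) size)
                               (x∈ ∷ pad⊆) (x∈ ∷ xs⊆) (x∉xs AllPairs.∷ uxs)))
                (sums-unique (suc t) xs pad size pad⊆ xs⊆ uxs)
                disjoint
    where
    padded-size : ∀ {M} → length M ≡ suc t → length (pad ++ M) ≡ 3
    padded-size {M} |M| =
      trans (length-++ pad) (trans (cong (_+_ (length pad)) |M|) (trans (+-comm (length pad) (suc t)) size))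
    disjoint : ∀ {v} → v ∈ map (_+_ x) (sums t (x ∷ xs)) × v ∈ sums (suc t) xs → ⊥
    disjoint (v∈₁ , v∈₂) with ∈-map⁻ (_+_ x) v∈₁
    ... | s₁ , s₁∈ , refl with sums-multiset t (x ∷ xs) s₁∈ | sums-multiset (suc t) xs v∈₂
    ... | M₁ , |M₁| , M₁⊆ , ΣM₁ | M₂ , |M₂| , M₂⊆ , ΣM₂ =
      All.lookup x∉xs (All.lookup M₂⊆ (∈-resp-↭ x∷M₁↭M₂ (here refl))) refl
      where
      inA′ : ∀ {M} → All (_∈ x ∷ xs) M → All (_∈ A′) M
      inA′ = All.map λ { (here refl) → x∈ ; (there y∈) → All.lookup xs⊆ y∈ }
      same-sum : sum (pad ++ x ∷ M₁) ≡ sum (pad ++ M₂)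
      same-sum = begin
        sum (pad ++ x ∷ M₁)     ≡⟨ sum-++ pad (x ∷ M₁) ⟩
        sum pad + (x + sum M₁)  ≡⟨ cong (λ s → sum pad + (x + s)) ΣM₁ ⟩
        sum pad + (x + s₁)      ≡⟨ cong (_+_ (sum pad)) ΣM₂ ⟨
        sum pad + sum M₂        ≡⟨ sum-++ pad M₂ ⟨
        sum (pad ++ M₂)         ∎
        where open ≡-Reasoning
      x∷M₁↭M₂ : x ∷ M₁ ↭ M₂
      x∷M₁↭M₂ = ↭-cancel-prefix pad
        (b₃-multisets (padded-size (cong suc |M₁|)) (padded-size |M₂|)
          (Allₚ.++⁺ pad⊆ (inA′ (here refl ∷ M₁⊆))) (Allₚ.++⁺ pad⊆ (All.map (All.lookup xs⊆) M₂⊆))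
          same-sum)

choose-2 : ∀ n → 2 * (suc n C 2) ≡ suc n * n
choose-2 zero    = cong (2 *_) (k>n⇒nCk≡0 {1} {2} (s≤s (s≤s z≤n)))
choose-2 (suc n) = begin
  2 * (suc (suc n) C 2)                   ≡⟨ cong (2 *_) (sym (nCk+nC[k+1]≡[n+1]C[k+1] (suc n) 1)) ⟩
  2 * (suc n C 1 + suc n C 2)             ≡⟨ *-distribˡ-+ 2 (suc n C 1) (suc n C 2) ⟩
  2 * (suc n C 1) + 2 * (suc n C 2)       ≡⟨ cong₂ (λ u v → 2 * u + v) (nC1≡n (suc n)) (choose-2 n) ⟩
  2 * suc n + suc n * n                   ≡⟨ collect n ⟩
  suc (suc n) * suc n                     ∎
  where
  open ≡-Reasoning
  collect : ∀ n → 2 * suc n + suc n * n ≡ suc (suc n) * suc n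
  collect = solve-∀

choose-3 : ∀ n → 6 * (suc (suc n) C 3) ≡ suc (suc n) * suc n * n
choose-3 zero    = cong (6 *_) (k>n⇒nCk≡0 {2} {3} (s≤s (s≤s (s≤s z≤n))))
choose-3 (suc n) = begin
  6 * (suc (suc (suc n)) C 3)             ≡⟨ cong (6 *_) (sym (nCk+nC[k+1]≡[n+1]C[k+1] (suc (suc n)) 2)) ⟩
  6 * (suc (suc n) C 2 + suc (suc n) C 3) ≡⟨ split (suc (suc n) C 2) (suc (suc n) C 3) ⟩
  3 * (2 * (suc (suc n) C 2)) + 6 * (suc (suc n) C 3)
    ≡⟨ cong₂ (λ u v → 3 * u + v) (choose-2 (suc n)) (choose-3 n) ⟩
  3 * (suc (suc n) * suc n) + suc (suc n) * suc n * n ≡⟨ collect n ⟩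
  suc (suc (suc n)) * suc (suc n) * suc n ∎
  where
  open ≡-Reasoning
  split : ∀ u v → 6 * (u + v) ≡ 3 * (2 * u) + 6 * v
  split = solve-∀
  collect : ∀ n → 3 * (suc (suc n) * suc n) + suc (suc n) * suc n * n ≡ suc (suc (suc n)) * suc (suc n) * suc n
  collect = solve-∀

-- Index pairs (j , t) of the elements j m + t a + s of S below 5m, and their weight
-- 2j + 3t: since 2a = 3m + k, such an element lies at 2x ≈ weight · m.

Pair : Set
Pair = ℕ × ℕ

weight : Pair → ℕ
weight (j , t) = 2 * j + 3 * t

weight-≥ : ∀ j t → 2 * (j + t) ≤ weight (j , t)
weight-≥ j t = subst (_≤ weight (j , t)) (sym (*-distribˡ-+ 2 j t)) (+-monoʳ-≤ (2 * j) (*-monoˡ-≤ t (n≤1+n 2)))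

weight-≤ : ∀ j t → weight (j , t) ≤ 3 * (j + t)
weight-≤ j t = subst (weight (j , t) ≤_) (sym (*-distribˡ-+ 3 j t)) (+-monoˡ-≤ (3 * t) (*-monoˡ-≤ j (n≤1+n 2)))

weight⇒j< : ∀ j t c → weight (j , t) < 2 * c → j < c
weight⇒j< j t c w< = *-cancelˡ-< 2 j c (≤-<-trans (m≤m+n (2 * j) (3 * t)) w<)

weight⇒t< : ∀ j t c → weight (j , t) < 3 * c → t < c
weight⇒t< j t c w< = *-cancelˡ-< 3 t c (≤-<-trans (m≤n+m (3 * t) (2 * j)) w<)

grid : List Pair
grid = cartesianProduct (upTo 5) (upTo 4)

grid-complete : ∀ {j t} → weight (j , t) < 10 → (j , t) ∈ grid
grid-complete {j} {t} w<10 =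
  ∈-cartesianProduct⁺ (∈-upTo⁺ (weight⇒j< j t 5 w<10)) (∈-upTo⁺ (weight⇒t< j t 4 (≤-trans w<10 (m≤m+n 10 2))))

grid-t≤3 : ∀ {p} → p ∈ grid → proj₂ p ≤ 3
grid-t≤3 p∈ = ≤-pred (∈-upTo⁻ (proj₂ (∈-cartesianProduct⁻ (upTo 5) (upTo 4) p∈)))

-- Pairs of the elements of L = S ∩ [0,4m), of the primitive ones, and of D ∩ [4m,5m).
lowPairs primPairs gapPairs : List Pair
lowPairs  = filter (λ p → weight p <? 8) grid
primPairs = filter (λ p → proj₁ p + proj₂ p ≟ 1) grid
gapPairs  = filter (λ p → 8 ≤? weight p) (filter (λ p → weight p <? 10) grid)

-- `precedes p q`: every element of block p lies below every element of block q
-- (q has larger weight, or the same weight and t raised by 2 from t ≤ 1).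
precedes : Pair → Pair → Bool
precedes p q = (weight p <ᵇ weight q)
             ∨ ((weight p ≡ᵇ weight q) ∧ ((proj₂ p ≤ᵇ 1) ∧ (proj₂ p + 2 ≡ᵇ proj₂ q)))

separated : Pair → Pair → Bool
separated p q = precedes p q ∨ precedes q p

pairwiseSeparated : List Pair → Bool
pairwiseSeparated []       = true
pairwiseSeparated (p ∷ ps) = all (separated p) ps ∧ pairwiseSeparated ps

W₀-from : ∀ (T : NSData) {c μ q ρ p l d} →
  conductor T ≡ c → multiplicity T ≡ μ → qOf T ≡ q → ρOf T ≡ ρ →
  count (isPrimitive T) (range 0 c) ≡ p → count (mem T) (range 0 c) ≡ l →
  count (inD T) (range c (c + μ)) ≡ d →
  W₀ T ≡ (+ (p * l) ℤ.- + (q * d)) ℤ.+ + ρ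
W₀-from T refl refl refl refl refl refl refl = refl

difference : ∀ X Y Z → X + Z ≡ Y → (+ X ℤ.- + Y) ℤ.+ + 0 ≡ - (+ Z)
difference X Y Z X+Z≡Y = begin
  (+ X ℤ.- + Y) ℤ.+ + 0 ≡⟨ ℤₚ.+-identityʳ (+ X ℤ.- + Y) ⟩
  + X ℤ.- + Y           ≡⟨ ℤₚ.[+m]-[+n]≡m⊖n X Y ⟩
  X ⊖ Y                 ≡⟨ ℤₚ.⊖-≤ X≤Y ⟩
  - (+ (Y ∸ X))         ≡⟨ cong (λ y → - (+ (y ∸ X))) (sym X+Z≡Y) ⟩
  - (+ (X + Z ∸ X))     ≡⟨ cong (λ z → - (+ z)) (m+n∸m≡n X Z) ⟩
  - (+ Z)               ∎
  where
  open ≡-Reasoning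
  X≤Y : X ≤ Y
  X≤Y = subst (X ≤_) X+Z≡Y (m≤m+n X Z)

-- The count behind W₀(S) = −C(n, 3): for ℓ = n − 1 ≥ 1, ℓ₂ = ℓ(ℓ+1)/2 and
-- ℓ₃ = ℓ(ℓ+1)(ℓ+2)/6 (the numbers of multisets of size 2 and 3),
-- (ℓ + 1)(4 + 3ℓ + ℓ₂) + C(ℓ + 1, 3) = 4 (ℓ₃ + ℓ₂ + ℓ + 1).
count-identity : ∀ {ℓ ℓ₂ ℓ₃} l → ℓ ≡ suc l →
  2 * ℓ₂ ≡ ℓ * suc ℓ → 6 * ℓ₃ ≡ ℓ * suc ℓ * suc (suc ℓ) →
  (ℓ + 1) * (4 + 3 * ℓ + ℓ₂) + suc ℓ C 3 ≡ 4 * (ℓ₃ + (ℓ₂ + (ℓ + 1)))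
count-identity {ℓ} {ℓ₂} {ℓ₃} l refl h₂ h₃ = *-cancelˡ-≡ _ _ 6 (begin
  6 * ((ℓ + 1) * (4 + 3 * ℓ + ℓ₂) + suc ℓ C 3)
    ≡⟨ expand ℓ ℓ₂ (suc ℓ C 3) ⟩
  6 * (ℓ + 1) * (4 + 3 * ℓ) + 3 * (ℓ + 1) * (2 * ℓ₂) + 6 * (suc ℓ C 3)
    ≡⟨ cong₂ (λ u v → 6 * (ℓ + 1) * (4 + 3 * ℓ) + 3 * (ℓ + 1) * u + v) h₂ (choose-3 l) ⟩
  6 * (ℓ + 1) * (4 + 3 * ℓ) + 3 * (ℓ + 1) * (ℓ * suc ℓ) + suc ℓ * ℓ * l
    ≡⟨ polynomial l ⟩
  4 * (ℓ * suc ℓ * suc (suc ℓ)) + 12 * (ℓ * suc ℓ) + 24 * (ℓ + 1)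
    ≡⟨ cong₂ (λ u v → 4 * u + 12 * v + 24 * (ℓ + 1)) (sym h₃) (sym h₂) ⟩
  4 * (6 * ℓ₃) + 12 * (2 * ℓ₂) + 24 * (ℓ + 1)
    ≡⟨ collect ℓ ℓ₂ ℓ₃ ⟩
  6 * (4 * (ℓ₃ + (ℓ₂ + (ℓ + 1)))) ∎)
  where
  open ≡-Reasoning
  expand : ∀ ℓ ℓ₂ c → 6 * ((ℓ + 1) * (4 + 3 * ℓ + ℓ₂) + c)
                    ≡ 6 * (ℓ + 1) * (4 + 3 * ℓ) + 3 * (ℓ + 1) * (2 * ℓ₂) + 6 * c
  expand = solve-∀
  polynomial : ∀ l → let ℓ = suc l in
    6 * (ℓ + 1) * (4 + 3 * ℓ) + 3 * (ℓ + 1) * (ℓ * suc ℓ) + suc ℓ * ℓ * l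
    ≡ 4 * (ℓ * suc ℓ * suc (suc ℓ)) + 12 * (ℓ * suc ℓ) + 24 * (ℓ + 1)
  polynomial = solve-∀
  collect : ∀ ℓ ℓ₂ ℓ₃ → 4 * (6 * ℓ₃) + 12 * (2 * ℓ₂) + 24 * (ℓ + 1) ≡ 6 * (4 * (ℓ₃ + (ℓ₂ + (ℓ + 1))))
  collect = solve-∀

bound-positive : ∀ {r xs} → Unique xs → 2 ≤ length xs → All (_≤ r) xs → 1 ≤ r
bound-positive {zero} {x ∷ y ∷ _} ((x≢y ∷ _) AllPairs.∷ _) _ (z≤n ∷ z≤n ∷ _) = ⊥-elim (x≢y refl)
bound-positive {zero} {_ ∷ []} _ (s≤s ()) _
bound-positive {suc r} _ _ _ = s≤s z≤n

-- The analysis of S = ⟨{m} ∪ (a + A′)⟩_{4m} under the hypotheses of the corollary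
-- (with r < k, and r ≥ 1 which follows from |A′| ≥ 2).
module Construction
  (A′ : List ℕ) (A′-unique : Unique A′) (0∈A′ : 0 ∈ A′) (isB₃ : IsB₃ A′)
  (r : ℕ) (A′≤r : All (_≤ r) A′) (1≤r : 1 ≤ r)
  (k m a : ℕ) (r<k : r < k) (m-large : 3 * k + 6 * r + 2 ≤ m) (2a≡ : 2 * a ≡ 3 * m + k)
  where

  1≤k : 1 ≤ k
  1≤k = ≤-trans (s≤s z≤n) r<k

  1≤m : 1 ≤ m
  1≤m = ≤-trans (s≤s z≤n) (≤-trans (m≤n+m 2 (3 * k + 6 * r)) m-large)

  m≤a : m ≤ a
  m≤a = *-cancelˡ-≤ 2 (begin
    2 * m       ≤⟨ *-monoˡ-≤ m (n≤1+n 2) ⟩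
    3 * m       ≤⟨ m≤m+n (3 * m) k ⟩
    3 * m + k   ≡⟨ 2a≡ ⟨
    2 * a       ∎)
    where open ≤-Reasoning

  value : Pair → ℕ → ℕ
  value (j , t) s = j * m + (t * a + s)

  excess : ℕ → ℕ → ℕ
  excess t s = t * k + 2 * s

  doubling : ∀ j t s → 2 * value (j , t) s ≡ weight (j , t) * m + excess t s
  doubling j t s = begin
    2 * (j * m + (t * a + s))           ≡⟨ expand j m t a s ⟩
    2 * j * m + t * (2 * a) + 2 * s     ≡⟨ cong (λ x → 2 * j * m + t * x + 2 * s) 2a≡ ⟩
    2 * j * m + t * (3 * m + k) + 2 * s ≡⟨ collect j m t k s ⟩
    (2 * j + 3 * t) * m + (t * k + 2 * s) ∎
    where
    open ≡-Reasoning
    expand : ∀ j m t a s → 2 * (j * m + (t * a + s)) ≡ 2 * j * m + t * (2 * a) + 2 * s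
    expand = solve-∀
    collect : ∀ j m t k s → 2 * j * m + t * (3 * m + k) + 2 * s ≡ (2 * j + 3 * t) * m + (t * k + 2 * s)
    collect = solve-∀

  excess-≤ : ∀ t {s} → s ≤ t * r → excess t s ≤ t * (k + 2 * r)
  excess-≤ t {s} s≤tr = begin
    t * k + 2 * s       ≤⟨ +-monoʳ-≤ (t * k) (*-monoʳ-≤ 2 s≤tr) ⟩
    t * k + 2 * (t * r) ≡⟨ regroup t k r ⟩
    t * (k + 2 * r)     ∎
    where
    open ≤-Reasoning
    regroup : ∀ t k r → t * k + 2 * (t * r) ≡ t * (k + 2 * r)
    regroup = solve-∀

  2≤k+2r : 2 ≤ k + 2 * r
  2≤k+2r = +-mono-≤ 1≤k (≤-trans 1≤r (m≤m+n r (r + 0)))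

  excess-<m : ∀ {t s} → t ≤ 3 → s ≤ t * r → excess t s < m
  excess-<m {t} {s} t≤3 s≤tr = begin-strict
    excess t s           ≤⟨ excess-≤ t s≤tr ⟩
    t * (k + 2 * r)      ≤⟨ *-monoˡ-≤ (k + 2 * r) t≤3 ⟩
    3 * (k + 2 * r)      <⟨ m<m+n (3 * (k + 2 * r)) z<s ⟩
    3 * (k + 2 * r) + 2  ≡⟨ expand k r ⟩
    3 * k + 6 * r + 2    ≤⟨ m-large ⟩
    m                    ∎
    where
    open ≤-Reasoning
    expand : ∀ k r → 3 * (k + 2 * r) + 2 ≡ 3 * k + 6 * r + 2
    expand = solve-∀

  excess+4≤m : ∀ {t s} → t ≤ 2 → s ≤ t * r → excess t s + 4 ≤ m
  excess+4≤m {t} {s} t≤2 s≤tr = begin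
    excess t s + 4                    ≤⟨ +-monoˡ-≤ 4 (≤-trans (excess-≤ t s≤tr) (*-monoˡ-≤ (k + 2 * r) t≤2)) ⟩
    2 * (k + 2 * r) + 4               ≤⟨ +-monoʳ-≤ (2 * (k + 2 * r)) (+-monoˡ-≤ 2 2≤k+2r) ⟩
    2 * (k + 2 * r) + (k + 2 * r + 2) ≡⟨ expand k r ⟩
    3 * k + 6 * r + 2                 ≤⟨ m-large ⟩
    m                                 ∎
    where
    open ≤-Reasoning
    expand : ∀ k r → 2 * (k + 2 * r) + (k + 2 * r + 2) ≡ 3 * k + 6 * r + 2
    expand = solve-∀

  window-lo : ∀ j t s → weight (j , t) * m ≤ 2 * value (j , t) s
  window-lo j t s = subst (weight (j , t) * m ≤_) (sym (doubling j t s)) (m≤m+n _ (excess t s))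

  window-hi : ∀ j t {s} → t ≤ 3 → s ≤ t * r → 2 * value (j , t) s < suc (weight (j , t)) * m
  window-hi j t {s} t≤3 s≤tr rewrite doubling j t s =
    subst (weight (j , t) * m + excess t s <_) (+-comm (weight (j , t) * m) m)
      (+-monoʳ-< (weight (j , t) * m) (excess-<m t≤3 s≤tr))

  window-hi₂ : ∀ j t {s} → t ≤ 2 → s ≤ t * r → 2 * value (j , t) s + 4 ≤ suc (weight (j , t)) * m
  window-hi₂ j t {s} t≤2 s≤tr rewrite doubling j t s =
    subst (weight (j , t) * m + excess t s + 4 ≤_) (+-comm (weight (j , t) * m) m)
      (subst (_≤ weight (j , t) * m + m) (sym (+-assoc (weight (j , t) * m) (excess t s) 4))
        (+-monoʳ-≤ (weight (j , t) * m) (excess+4≤m t≤2 s≤tr)))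

  s-bound : ∀ t {s} → s ∈ sums t A′ → s ≤ t * r
  s-bound t = sums-bound t A′ A′≤r

  weight-below : ∀ j t s W → 2 * value (j , t) s < W * m → weight (j , t) < W
  weight-below j t s W lt = *-cancelʳ-< m (weight (j , t)) W (≤-<-trans (window-lo j t s) lt)

  weight-above : ∀ j t {s} W → t ≤ 3 → s ≤ t * r → W * m ≤ 2 * value (j , t) s → W ≤ weight (j , t)
  weight-above j t W t≤3 s≤tr le =
    ≤-pred (*-cancelʳ-< m W (suc (weight (j , t))) (≤-<-trans le (window-hi j t t≤3 s≤tr)))

  -- Equal weights: raising t by 2 from t ≤ 1 raises the excess (this uses r < k).
  excess-step : ∀ {t s} s′ → t ≤ 1 → s ≤ t * r → excess t s < excess (t + 2) s′
  excess-step {t} {s} s′ t≤1 s≤tr = begin-strict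
    excess t s                ≤⟨ excess-≤ t s≤tr ⟩
    t * (k + 2 * r)           ≡⟨ *-distribˡ-+ t k (2 * r) ⟩
    t * k + t * (2 * r)       ≤⟨ +-monoʳ-≤ (t * k) (≤-trans (*-monoˡ-≤ (2 * r) t≤1) (≤-reflexive (+-identityʳ (2 * r)))) ⟩
    t * k + 2 * r             <⟨ +-monoʳ-< (t * k) (*-monoʳ-< 2 r<k) ⟩
    t * k + 2 * k             ≡⟨ *-distribʳ-+ k t 2 ⟨
    (t + 2) * k               ≤⟨ m≤m+n ((t + 2) * k) (2 * s′) ⟩
    excess (t + 2) s′         ∎
    where open ≤-Reasoning

  precedes⇒< : ∀ j t j′ t′ {s s′} → T (precedes (j , t) (j′ , t′)) → t ≤ 3 → s ∈ sums t A′ →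
    value (j , t) s < value (j′ , t′) s′
  precedes⇒< j t j′ t′ {s} {s′} prec t≤3 s∈ = *-cancelˡ-< 2 _ _ (by (Equivalence.to T-∨ prec))
    where
    w w′ : ℕ
    w  = weight (j , t)
    w′ = weight (j′ , t′)
    by : T (w <ᵇ w′) ⊎ T ((w ≡ᵇ w′) ∧ ((t ≤ᵇ 1) ∧ (t + 2 ≡ᵇ t′))) →
         2 * value (j , t) s < 2 * value (j′ , t′) s′
    by (inj₁ w<w′) = begin-strict
      2 * value (j , t) s    <⟨ window-hi j t t≤3 (s-bound t s∈) ⟩
      suc w * m              ≤⟨ *-monoˡ-≤ m (<ᵇ⇒< w w′ w<w′) ⟩
      w′ * m                 ≤⟨ window-lo j′ t′ s′ ⟩
      2 * value (j′ , t′) s′ ∎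
      where open ≤-Reasoning
    by (inj₂ same) with Equivalence.to T-∧ same
    ... | w≡w′ , step with Equivalence.to T-∧ step
    ... | t≤1 , t+2≡t′ = begin-strict
      2 * value (j , t) s    ≡⟨ doubling j t s ⟩
      w * m + excess t s     <⟨ +-monoʳ-< (w * m) (excess-step s′ (≤ᵇ⇒≤ t 1 t≤1) (s-bound t s∈)) ⟩
      w * m + excess (t + 2) s′ ≡⟨ cong₂ (λ v u → v * m + excess u s′) (≡ᵇ⇒≡ w w′ w≡w′) (≡ᵇ⇒≡ (t + 2) t′ t+2≡t′) ⟩
      w′ * m + excess t′ s′  ≡⟨ doubling j′ t′ s′ ⟨
      2 * value (j′ , t′) s′ ∎
      where open ≤-Reasoning

  -- Without repetition for t ≤ 3: pad multisets with copies of 0 ∈ A′ up to size 3.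
  sums-A′-unique : ∀ t → t ≤ 3 → Unique (sums t A′)
  sums-A′-unique t t≤3 =
    B₃Sums.sums-unique isB₃ t A′ (replicate (3 ∸ t) 0)
      (trans (cong (_+_ t) (length-replicate (3 ∸ t))) (m+[n∸m]≡n t≤3))
      (Allₚ.replicate⁺ (3 ∸ t) 0∈A′) (All.tabulate (λ x∈ → x∈)) A′-unique

  record Element (P : Pair → Set) (y : ℕ) : Set where
    constructor element
    field
      j t s : ℕ
      holds : P (j , t)
      s∈    : s ∈ sums t A′
      y≡    : y ≡ value (j , t) s

  block : Pair → List ℕ
  block (j , t) = map (value (j , t)) (sums t A′)

  blocks : List Pair → List ℕ
  blocks []       = []
  blocks (p ∷ ps) = block p ++ blocks ps

  ∈-blocks⁺ : ∀ ps j t {s} → (j , t) ∈ ps → s ∈ sums t A′ → value (j , t) s ∈ blocks ps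
  ∈-blocks⁺ (p ∷ ps) j t (here refl) s∈ = ∈-++⁺ˡ (∈-map⁺ (value (j , t)) s∈)
  ∈-blocks⁺ (p ∷ ps) j t (there q∈)  s∈ = ∈-++⁺ʳ (block p) (∈-blocks⁺ ps j t q∈ s∈)

  ∈-blocks⁻ : ∀ ps {y} → y ∈ blocks ps → Element (_∈ ps) y
  ∈-blocks⁻ ((j , t) ∷ ps) y∈ with ∈-++⁻ (block (j , t)) y∈
  ... | inj₁ y∈₁ with ∈-map⁻ (value (j , t)) y∈₁
  ...   | s , s∈ , y≡ = element j t s (here refl) s∈ y≡
  ∈-blocks⁻ ((j , t) ∷ ps) y∈ | inj₂ y∈₂ with ∈-blocks⁻ ps y∈₂
  ...   | element j′ t′ s′ q∈ s′∈ y≡ = element j′ t′ s′ (there q∈) s′∈ y≡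

  length-blocks : ∀ ps → length (blocks ps) ≡ sum (map (λ p → length (sums (proj₂ p) A′)) ps)
  length-blocks []             = refl
  length-blocks ((j , t) ∷ ps) = trans (length-++ (block (j , t)))
    (cong₂ _+_ (length-map (value (j , t)) (sums t A′)) (length-blocks ps))

  blocks-unique : ∀ ps → T (pairwiseSeparated ps) → (∀ {p} → p ∈ ps → proj₂ p ≤ 3) →
    Unique (blocks ps)
  blocks-unique []             _   _   = AllPairs.[]
  blocks-unique ((j , t) ∷ ps) sep t≤3 with Equivalence.to T-∧ sep
  ... | sep-head , sep-tail =
    Uniqueₚ.++⁺ (Uniqueₚ.map⁺ (+-cancelˡ-≡ (t * a) _ _ ∘ +-cancelˡ-≡ (j * m) _ _)
                              (sums-A′-unique t (t≤3 (here refl))))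
                (blocks-unique ps sep-tail (t≤3 ∘ there))
                disjoint
    where
    disjoint : ∀ {y} → y ∈ block (j , t) × y ∈ blocks ps → ⊥
    disjoint (y∈₁ , y∈₂) with ∈-map⁻ (value (j , t)) y∈₁ | ∈-blocks⁻ ps y∈₂
    ... | s , s∈ , refl | element j′ t′ s′ q∈ s′∈ same
      with Equivalence.to T-∨ (All.lookup (Allₚ.all⁺ _ ps sep-head) q∈)
    ...   | inj₁ p≺q = <-irrefl same (precedes⇒< j t j′ t′ p≺q (t≤3 (here refl)) s∈)
    ...   | inj₂ q≺p = <-irrefl (sym same) (precedes⇒< j′ t′ j t q≺p (t≤3 (there q∈)) s′∈)

  generators : List ℕ
  generators = m ∷ map (_+_ a) A′

  generators-positive : All (1 ≤_) generators
  generators-positive = 1≤m ∷ Allₚ.map⁺ (All.tabulate (λ {x} _ → ≤-trans 1≤m (≤-trans m≤a (m≤m+n a x))))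

  S : NSData
  S = ⟨ generators ⟩ (4 * m)

  combination⇒element : ∀ {x} → Combination generators x → Element (λ _ → ⊤) x
  combination⇒element (j ∷ c) with shifted-combination⁻ a A′ c
  ... | t , s , s∈ , refl = element j t s tt s∈ refl

  value∈S : ∀ j t {s} → s ∈ sums t A′ → T (mem S (value (j , t) s))
  value∈S j t s∈ = Equivalence.from T-∨ (inj₁ (Combination⇒isComb generators-positive
                                                 (j ∷ shifted-combination⁺ a t A′ s∈)))

  S-below-4m : ∀ {x} → x < 4 * m → T (mem S x) → Combination generators x
  S-below-4m {x} x<4m x∈S with Equivalence.to T-∨ x∈S
  ... | inj₁ comb = isComb⇒Combination generators x comb
  ... | inj₂ 4m≤x = ⊥-elim (<⇒≱ x<4m (≤ᵇ⇒≤ (4 * m) x 4m≤x))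

  -- An element with j + t ≥ 1 is at least m (its weight is at least 2).
  value-≥m : ∀ j t s → 1 ≤ j + t → m ≤ value (j , t) s
  value-≥m j t s 1≤j+t = *-cancelˡ-≤ 2 (begin
    2 * m                 ≤⟨ *-monoˡ-≤ m (≤-trans (*-monoʳ-≤ 2 1≤j+t) (weight-≥ j t)) ⟩
    weight (j , t) * m    ≤⟨ window-lo j t s ⟩
    2 * value (j , t) s   ∎)
    where open ≤-Reasoning

  index-positive : ∀ j t {s} → s ∈ sums t A′ → 1 ≤ value (j , t) s → 1 ≤ j + t
  index-positive zero    zero    (here refl) ()
  index-positive zero    (suc t) _ _ = s≤s z≤n
  index-positive (suc j) t       _ _ = s≤s z≤n

  memStar⇒≥m : ∀ {x} → T (memStar S x) → m ≤ x
  memStar⇒≥m {x} x∈S* with Equivalence.to T-∧ x∈S*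
  ... | 1≤x , x∈S with x <? 4 * m
  ...   | no  x≮4m = ≤-trans (m≤n*m m 4) (≮⇒≥ x≮4m)
  ...   | yes x<4m with combination⇒element (S-below-4m x<4m x∈S)
  ...     | element j t s _ s∈ refl = value-≥m j t s (index-positive j t s∈ (≤ᵇ⇒≤ 1 x 1≤x))

  value∈S* : ∀ j t {s} → 1 ≤ j + t → s ∈ sums t A′ → T (memStar S (value (j , t) s))
  value∈S* j t {s} 1≤j+t s∈ =
    Equivalence.from T-∧ (≤⇒≤ᵇ (≤-trans 1≤m (value-≥m j t s 1≤j+t)) , value∈S j t s∈)

  generator∈S* : ∀ {g} → g ∈ generators → T (memStar S g)
  generator∈S* g∈ = Equivalence.from T-∧ (≤⇒≤ᵇ (All.lookup generators-positive g∈) ,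
    Equivalence.from T-∨ (inj₁ (Combination⇒isComb generators-positive (combination-generator g∈))))

  sum∈D : ∀ {g y} → T (memStar S g) → T (memStar S y) → T (inD S (g + y))
  sum∈D {g} {y} g∈S* y∈S* = any⁺ _ (lose g∈range (Equivalence.from T-∧ (g∈S* , y∈S*′)))
    where
    g∈range : g ∈ range 1 (g + y)
    g∈range = ∈-range⁺ (≤ᵇ⇒≤ 1 g (proj₁ (Equivalence.to T-∧ g∈S*)))
                        (m<m+n g (≤ᵇ⇒≤ 1 y (proj₁ (Equivalence.to T-∧ y∈S*))))
    y∈S*′ : T (memStar S (g + y ∸ g))
    y∈S*′ = subst (T ∘ memStar S) (sym (m+n∸m≡n g y)) y∈S*

  D-split : ∀ {x} → T (inD S x) → ∃ λ b → b < x × T (memStar S b) × T (memStar S (x ∸ b))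
  D-split {x} x∈D with find (any⁻ _ (range 1 x) x∈D)
  ... | b , b∈ , both with Equivalence.to T-∧ both
  ...   | b∈S* , x-b∈S* = b , proj₂ (∈-range⁻ b∈) , b∈S* , x-b∈S*

  D-≥2m : ∀ {x} → T (inD S x) → 2 * m ≤ x
  D-≥2m {x} x∈D with D-split x∈D
  ... | b , b<x , b∈S* , x-b∈S* =
    subst (2 * m ≤_) (m+[n∸m]≡n (<⇒≤ b<x))
      (+-mono-≤ (memStar⇒≥m b∈S*) (subst (_≤ x ∸ b) (sym (+-identityʳ m)) (memStar⇒≥m x-b∈S*)))

  -- Elements with j + t ≥ 2 split off a generator, hence lie in D.
  value∈D : ∀ j t {s} → 2 ≤ j + t → s ∈ sums t A′ → T (inD S (value (j , t) s))
  value∈D (suc j) t {s} (s≤s 1≤j+t) s∈ =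
    subst (T ∘ inD S) (sym (+-assoc m (j * m) (t * a + s)))
      (sum∈D (generator∈S* (here refl)) (value∈S* j t 1≤j+t s∈))
  value∈D zero (suc t) (s≤s 1≤t) s∈ with sums-split t A′ s∈
  ... | z , s′ , z∈ , s′∈ , refl =
    subst (T ∘ inD S) (regroup a z t s′)
      (sum∈D (generator∈S* (there (∈-map⁺ (_+_ a) z∈))) (value∈S* 0 t 1≤t s′∈))
    where
    regroup : ∀ a z t s′ → a + z + (t * a + s′) ≡ suc t * a + (z + s′)
    regroup = solve-∀

  -- Below 5m every element of D is again an element value (j , t) s: both summands
  -- are below 4m, hence combinations of the generators.
  D-below-5m : ∀ {x} → T (inD S x) → x < 5 * m → Element (λ _ → ⊤) x
  D-below-5m {x} x∈D x<5m with D-split x∈D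
  ... | b , b<x , b∈S* , x-b∈S* =
    combination⇒element (subst (Combination generators) (m+[n∸m]≡n (<⇒≤ b<x))
      (combination-+ (summand b∈S* (part<4m (memStar⇒≥m x-b∈S*) (subst (_< 5 * m) (sym x≡) x<5m)))
                     (summand x-b∈S* (part<4m (memStar⇒≥m b∈S*)
                       (subst (_< 5 * m) (sym (trans (+-comm (x ∸ b) b) x≡)) x<5m)))))
    where
    x≡ : b + (x ∸ b) ≡ x
    x≡ = m+[n∸m]≡n (<⇒≤ b<x)
    part<4m : ∀ {u v} → m ≤ v → u + v < 5 * m → u < 4 * m
    part<4m {u} {v} m≤v u+v<5m = +-cancelˡ-< m u (4 * m)
      (≤-<-trans (≤-reflexive (+-comm m u)) (≤-<-trans (+-monoʳ-≤ u m≤v) u+v<5m))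
    summand : ∀ {y} → T (memStar S y) → y < 4 * m → Combination generators y
    summand y∈S* y<4m = S-below-4m y<4m (proj₂ (Equivalence.to T-∧ y∈S*))

  double-< : ∀ {x} c → x < c * m → 2 * x < 2 * c * m
  double-< {x} c x<cm = subst (2 * x <_) (sym (*-assoc 2 c m)) (*-monoʳ-< 2 x<cm)

  halve-< : ∀ {x} c → 2 * x < 2 * c * m → x < c * m
  halve-< {x} c 2x< = *-cancelˡ-< 2 x (c * m) (subst (2 * x <_) (*-assoc 2 c m) 2x<)

  halve-≤ : ∀ {x} c → 2 * c * m ≤ 2 * x → c * m ≤ x
  halve-≤ {x} c 2c≤ = *-cancelˡ-≤ 2 (subst (_≤ 2 * x) (*-assoc 2 c m) 2c≤)

  -- L = S ∩ [0, 4m) is the union of the blocks of weight below 8 (their separation,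
  -- `T (pairwiseSeparated lowPairs)`, holds by evaluation).  Their elements stay at
  -- least 2 below 4m ...
  low-top : ∀ {j t s} → (j , t) ∈ lowPairs → s ∈ sums t A′ → value (j , t) s + 2 ≤ 4 * m
  low-top {j} {t} {s} p∈ s∈ = *-cancelˡ-≤ 2 (begin
    2 * (value (j , t) s + 2)     ≡⟨ *-distribˡ-+ 2 (value (j , t) s) 2 ⟩
    2 * value (j , t) s + 4       ≤⟨ window-hi₂ j t t≤2 (s-bound t s∈) ⟩
    suc (weight (j , t)) * m      ≤⟨ *-monoˡ-≤ m w<8 ⟩
    2 * 4 * m                     ≡⟨ *-assoc 2 4 m ⟩
    2 * (4 * m)                   ∎)
    where
    open ≤-Reasoning
    w<8 : weight (j , t) < 8
    w<8 = proj₂ (∈-filter⁻ (λ p → weight p <? 8) {xs = grid} p∈)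
    t≤2 : t ≤ 2
    t≤2 = ≤-pred (weight⇒t< j t 3 (m<n⇒m<1+n w<8))

  low-element : ∀ {x} → x < 4 * m → T (mem S x) → Element (_∈ lowPairs) x
  low-element x<4m x∈S with combination⇒element (S-below-4m x<4m x∈S)
  ... | element j t s _ s∈ refl =
    element j t s (∈-filter⁺ (λ p → weight p <? 8) (grid-complete (m<n⇒m<1+n (m<n⇒m<1+n w<8))) w<8) s∈ refl
    where
    w<8 : weight (j , t) < 8
    w<8 = weight-below j t s 8 (double-< 4 x<4m)

  low-enumeration : count (mem S) (range 0 (4 * m)) ≡ length (blocks lowPairs)
  low-enumeration = count-enumeration (mem S) (range-unique 0 (4 * m))
    (blocks-unique lowPairs tt (grid-t≤3 ∘ proj₁ ∘ ∈-filter⁻ (λ p → weight p <? 8) {xs = grid}))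
    listed complete
    where
    listed : ∀ {y} → y ∈ blocks lowPairs → y ∈ range 0 (4 * m) × T (mem S y)
    listed y∈ with ∈-blocks⁻ lowPairs y∈
    ... | element j t s p∈ s∈ refl =
      ∈-range⁺ z≤n (<-≤-trans (m<m+n _ z<s) (low-top p∈ s∈)) , value∈S j t s∈
    complete : ∀ {x} → x ∈ range 0 (4 * m) → T (mem S x) → x ∈ blocks lowPairs
    complete x∈ x∈S with low-element (proj₂ (∈-range⁻ x∈)) x∈S
    ... | element j t s p∈ s∈ refl = ∈-blocks⁺ lowPairs j t p∈ s∈

  gap-enumeration : count (inD S) (range (4 * m) (4 * m + m)) ≡ length (blocks gapPairs)
  gap-enumeration = count-enumeration (inD S) (range-unique (4 * m) (4 * m + m))
    (blocks-unique gapPairs tt (grid-t≤3 ∘ proj₁ ∘ in-gap))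
    listed complete
    where
    in-gap : ∀ {p} → p ∈ gapPairs → p ∈ grid × weight p < 10 × 8 ≤ weight p
    in-gap p∈ with ∈-filter⁻ (λ p → 8 ≤? weight p) {xs = filter (λ p → weight p <? 10) grid} p∈
    ... | p∈′ , 8≤w with ∈-filter⁻ (λ p → weight p <? 10) {xs = grid} p∈′
    ...   | p∈grid , w<10 = p∈grid , w<10 , 8≤w
    5m≡ : 5 * m ≡ 4 * m + m
    5m≡ = +-comm m (4 * m)
    listed : ∀ {y} → y ∈ blocks gapPairs → y ∈ range (4 * m) (4 * m + m) × T (inD S y)
    listed y∈ with ∈-blocks⁻ gapPairs y∈
    ... | element j t s p∈ s∈ refl with in-gap p∈
    ...   | p∈grid , w<10 , 8≤w =
      ∈-range⁺ (halve-≤ 4 (≤-trans (*-monoˡ-≤ m 8≤w) (window-lo j t s)))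
               (subst (value (j , t) s <_) 5m≡
                 (halve-< 5 (<-≤-trans (window-hi j t (grid-t≤3 p∈grid) (s-bound t s∈)) (*-monoˡ-≤ m w<10)))) ,
      value∈D j t 2≤j+t s∈
      where
      2≤j+t : 2 ≤ j + t
      2≤j+t = *-cancelˡ-< 3 1 (j + t) (<-≤-trans (s≤s (s≤s (s≤s (s≤s z≤n)))) (≤-trans 8≤w (weight-≤ j t)))
    complete : ∀ {x} → x ∈ range (4 * m) (4 * m + m) → T (inD S x) → x ∈ blocks gapPairs
    complete {x} x∈ x∈D with ∈-range⁻ x∈
    ... | 4m≤x , x<5m′ with D-below-5m x∈D (subst (x <_) (sym 5m≡) x<5m′)
    ...   | element j t s _ s∈ refl =
      ∈-blocks⁺ gapPairs j t (∈-filter⁺ (λ p → 8 ≤? weight p)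
        (∈-filter⁺ (λ p → weight p <? 10) (grid-complete w<10) w<10) 8≤w) s∈
      where
      w<10 : weight (j , t) < 10
      w<10 = weight-below j t s 10 (double-< 5 (subst (value (j , t) s <_) (sym 5m≡) x<5m′))
      8≤w : 8 ≤ weight (j , t)
      8≤w = weight-above j t 8 (≤-pred (weight⇒t< j t 4 (≤-trans w<10 (m≤m+n 10 2))))
              (s-bound t s∈) (subst (_≤ 2 * value (j , t) s) (sym (*-assoc 2 4 m)) (*-monoʳ-≤ 2 4m≤x))

  prim-enumeration : count (isPrimitive S) (range 0 (4 * m)) ≡ length (blocks primPairs)
  prim-enumeration = count-enumeration (isPrimitive S) (range-unique 0 (4 * m))
    (blocks-unique primPairs tt (grid-t≤3 ∘ proj₁ ∘ ∈-filter⁻ prim? {xs = grid}))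
    listed complete
    where
    prim? : (p : Pair) → Dec (proj₁ p + proj₂ p ≡ 1)
    prim? p = proj₁ p + proj₂ p ≟ 1
    listed : ∀ {y} → y ∈ blocks primPairs → y ∈ range 0 (4 * m) × T (isPrimitive S y)
    listed y∈ with ∈-blocks⁻ primPairs y∈
    ... | element j t s p∈ s∈ refl with ∈-filter⁻ prim? {xs = grid} p∈
    ...   | p∈grid , j+t≡1 =
      ∈-range⁺ z≤n (<-≤-trans y<2m (*-monoˡ-≤ m {2} {4} (s≤s (s≤s z≤n)))) ,
      Equivalence.from T-∧ (value∈S* j t (≤-reflexive (sym j+t≡1)) s∈ ,
                            Equivalence.from T-not-≡ (¬T⇒≡false (λ y∈D → <⇒≱ y<2m (D-≥2m y∈D))))
      where
      y<2m : value (j , t) s < 2 * m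
      y<2m = halve-< 2 (<-≤-trans (window-hi j t (grid-t≤3 p∈grid) (s-bound t s∈))
                                  (*-monoˡ-≤ m (s≤s (subst (weight (j , t) ≤_) (cong (3 *_) j+t≡1) (weight-≤ j t)))))
    complete : ∀ {x} → x ∈ range 0 (4 * m) → T (isPrimitive S x) → x ∈ blocks primPairs
    complete {x} x∈ x-prim with Equivalence.to (T-∧ {memStar S x} {not (inD S x)}) x-prim
    ... | x∈S* , x∉D with Equivalence.to (T-∧ {1 ≤ᵇ x} {mem S x}) x∈S*
    ...   | 1≤x , x∈S with combination⇒element (S-below-4m (proj₂ (∈-range⁻ x∈)) x∈S)
    ...     | element j t s _ s∈ refl =
      ∈-blocks⁺ primPairs j t (∈-filter⁺ prim? (grid-complete w<10) j+t≡1) s∈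
      where
      1≤j+t : 1 ≤ j + t
      1≤j+t = index-positive j t s∈ (≤ᵇ⇒≤ 1 x 1≤x)
      j+t<2 : j + t < 2
      j+t<2 = ≰⇒> (λ 2≤j+t → subst T (Equivalence.to (T-not-≡ {inD S x}) x∉D) (value∈D j t 2≤j+t s∈))
      j+t≡1 : j + t ≡ 1
      j+t≡1 = ≤-antisym (≤-pred j+t<2) 1≤j+t
      w<10 : weight (j , t) < 10
      w<10 = ≤-<-trans (weight-≤ j t) (subst (λ u → 3 * u < 10) (sym j+t≡1) (s≤s (s≤s (s≤s (s≤s z≤n)))))

  1≤4m : 1 ≤ 4 * m
  1≤4m = ≤-trans 1≤m (m≤n*m m 4)

  4m-1<4m : 4 * m ∸ 1 < 4 * m
  4m-1<4m = subst (4 * m ∸ 1 <_) (trans (+-comm 1 (4 * m ∸ 1)) (m∸n+n≡m 1≤4m)) ≤-refl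

  4m-1∉S : ¬ T (mem S (4 * m ∸ 1))
  4m-1∉S 4m-1∈S with low-element 4m-1<4m 4m-1∈S
  ... | element j t s p∈ s∈ 4m-1≡x = <-irrefl refl (subst (_≤ x) (+-comm x 1) x+1≤x)
    where
    x = value (j , t) s
    x+1≤x : x + 1 ≤ x
    x+1≤x = subst (x + 1 ≤_) 4m-1≡x
      (m+n≤o⇒m≤o∸n (x + 1) (subst (_≤ 4 * m) (sym (+-assoc x 1 1)) (low-top p∈ s∈)))

  conductor-S : conductor S ≡ 4 * m
  conductor-S = firstWith-none _ (range 0 (4 * m)) (4 * m) no-suffix
    where
    no-suffix : ∀ {c} → c ∈ range 0 (4 * m) → ¬ T (all (mem S) (range c (4 * m)))
    no-suffix {c} c∈ all∈S = 4m-1∉S (All.lookup (Allₚ.all⁺ (mem S) (range c (4 * m)) all∈S)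
      (∈-range⁺ (m+n≤o⇒m≤o∸n c (subst (_≤ 4 * m) (+-comm 1 c) (proj₂ (∈-range⁻ c∈)))) 4m-1<4m))

  multiplicity-S : multiplicity S ≡ m
  multiplicity-S = firstWith-least (memStar S) (suc (4 * m)) 1≤m (s≤s (m≤n*m m 4))
    (generator∈S* (here refl)) (λ _ x<m x∈S* → <⇒≱ x<m (memStar⇒≥m x∈S*))

  q-S : qOf S ≡ 4
  q-S = trans (cong₂ (λ c μ → firstWith (λ q → c ≤ᵇ q * μ) (range 0 (suc c)) c) conductor-S multiplicity-S)
    (firstWith-least (λ q → 4 * m ≤ᵇ q * m) (4 * m) z≤n (s≤s (*-monoʳ-≤ 4 1≤m)) (≤⇒≤ᵇ (≤-refl {4 * m}))
      (λ {x} _ x<4 4m≤xm → <⇒≱ (*-monoˡ-< m {{>-nonZero 1≤m}} x<4) (≤ᵇ⇒≤ (4 * m) (x * m) 4m≤xm)))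

  ρ-S : ρOf S ≡ 0
  ρ-S = trans (cong₃ (λ q μ c → q * μ ∸ c) q-S multiplicity-S conductor-S) (n∸n≡0 (4 * m))
    where
    cong₃ : ∀ (f : ℕ → ℕ → ℕ → ℕ) {x x′ y y′ z z′} → x ≡ x′ → y ≡ y′ → z ≡ z′ → f x y z ≡ f x′ y′ z′
    cong₃ f refl refl refl = refl

  ℓ ℓ₂ ℓ₃ : ℕ
  ℓ  = length A′
  ℓ₂ = length (sums 2 A′)
  ℓ₃ = length (sums 3 A′)

  |L| : count (mem S) (range 0 (4 * m)) ≡ 4 + 3 * ℓ + ℓ₂
  |L| = trans low-enumeration (trans (length-blocks lowPairs)
    (trans (collect (length (sums 1 A′)) ℓ₂) (cong (λ u → 4 + 3 * u + ℓ₂) (length-sums₁ A′))))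
    where
    collect : ∀ u v → 1 + (u + (v + (1 + (u + (1 + (u + (1 + 0))))))) ≡ 4 + 3 * u + v
    collect = solve-∀

  |P∩L| : count (isPrimitive S) (range 0 (4 * m)) ≡ ℓ + 1
  |P∩L| = trans prim-enumeration (trans (length-blocks primPairs) (cong (_+ 1) (length-sums₁ A′)))

  |Dq| : count (inD S) (range (4 * m) (4 * m + m)) ≡ ℓ₃ + (ℓ₂ + (ℓ + 1))
  |Dq| = trans gap-enumeration (trans (length-blocks gapPairs)
    (cong (λ u → ℓ₃ + (ℓ₂ + (u + 1))) (length-sums₁ A′)))

  W₀-S : W₀ S ≡ (+ ((ℓ + 1) * (4 + 3 * ℓ + ℓ₂)) ℤ.- + (4 * (ℓ₃ + (ℓ₂ + (ℓ + 1))))) ℤ.+ + 0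
  W₀-S = W₀-from S conductor-S multiplicity-S q-S ρ-S |P∩L| |L| |Dq|

corollary3p4 : (n : ℕ) → 3 ≤ n →
    (A′ : List ℕ) → Unique A′ → length A′ ≡ n ∸ 1 → 0 ∈ A′ → IsB₃ A′ →
    (r : ℕ) → r ∈ A′ → All (λ x → x ≤ r) A′ →
    (k m : ℕ) → 1 ≤ k → 1 ≤ m → r + 1 ≤ k → 3 * k + 6 * r + 2 ≤ m → m % 2 ≡ k % 2 →
    (a : ℕ) → 2 * a ≡ 3 * m + k →
    W₀ (⟨ m ∷ map (λ x → a + x) A′ ⟩ (4 * m)) ≡ - (+ (n C 3))
corollary3p4 (suc (suc (suc l))) (s≤s (s≤s (s≤s _))) A′ A′-unique |A′| 0∈A′ isB₃ r _ A′≤r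
             k m _ _ r+1≤k m-large _ a 2a≡ = begin
  W₀ S                                                                         ≡⟨ W₀-S ⟩
  (+ ((ℓ + 1) * (4 + 3 * ℓ + ℓ₂)) ℤ.- + (4 * (ℓ₃ + (ℓ₂ + (ℓ + 1))))) ℤ.+ + 0 ≡⟨ difference _ _ _ multiset-count ⟩
  - (+ (suc ℓ C 3))                                                            ≡⟨ cong (λ len → - (+ (suc len C 3))) |A′| ⟩
  - (+ (suc (suc (suc l)) C 3))                                                ∎
  where
  open ≡-Reasoning
  r<k : r < k
  r<k = subst (_≤ k) (+-comm r 1) r+1≤k
  1≤r : 1 ≤ r
  1≤r = bound-positive A′-unique (subst (2 ≤_) (sym |A′|) (s≤s (s≤s z≤n))) A′≤r
  open Construction A′ A′-unique 0∈A′ isB₃ r A′≤r 1≤r k m a r<k m-large 2a≡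
  multiset-count : (ℓ + 1) * (4 + 3 * ℓ + ℓ₂) + suc ℓ C 3 ≡ 4 * (ℓ₃ + (ℓ₂ + (ℓ + 1)))
  multiset-count = count-identity {ℓ₃ = ℓ₃} (suc l) |A′| (length-sums₂ A′) (length-sums₃ A′)
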